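{- Let $\mathrm{t}$ be a full binary tree. Then (a) $\mathcal{S}(\mathrm{t})=0$ if and only if $\mathrm{t}=\{\emptyset\}$; and (b) otherwise \[\mathcal{S}(\mathrm{t})=\max\Big(\mathcal{S}_1(\mathrm{t}),\mathcal{S}_2(\mathrm{t}),\,2\min\big(\mathcal{S}_1(\mathrm{t}),\mathcal{S}_2(\mathrm{t})\big)+\mathbf{1}_{\{\mathcal{S}_1(\mathrm{t})>\mathcal{S}_2(\mathrm{t})\}}+1\Big),\] where $\mathcal{S}_i(\mathrm{t})=\mathcal{S}(\theta_i\mathrm{t})$.
   Context: Let $\mathcal{U}=\{1,2\}^*$ be the set of finite words over $\{1,2\}$ (including the empty word $\emptyset$); $uv$ denotes concatenation, $uV=\{uv:v\in V\}$. A binary tree is a finite set $\mathrm{t}\subset\mathcal{U}$ containing $\emptyset$ and closed under taking prefixes. The tree is full if for all $u\in\mathrm{t}$, $u1\in\mathrm{t}\iff u2\in\mathrm{t}$. For $u\in\mathrm{t}$, $\theta_u\mathrm{t}=\{v:uv\in\mathrm{t}\}$. Let $\preceq_{\mathrm{lex}}$ be the lexicographic order on $\mathcal{U}$ and $u\wedge v$ the longest common prefix. An embedding of $\mathrm{t}$ in $\mathrm{t}'$ is an injective map $\varphi:\mathrm{t}\to\mathrm{t}'$, strictly increasing for $\preceq_{\mathrm{lex}}$, with $\varphi(u\wedge v)=\varphi(u)\wedge\varphi(v)$ for all $u,v$. Define $\tau_0=\{\emptyset\}$, $\tau_1=\{\emptyset,1,2\}$, and for $m\ge1$: $\tau_{2m}=\{\emptyset\}\cup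 1\tau_m\cup 2\tau_{m-1}$, $\tau_{2m+1}=\{\emptyset\}\cup 1\tau_m\cup 2\tau_m$. The refined Horton--Strahler number is $\mathcal{S}(\mathrm{t})=\max\{r:\tau_r\text{ can be embedded in }\mathrm{t}\}$, and $\mathcal{S}_u(\mathrm{t})=\mathcal{S}(\theta_u\mathrm{t})$. -}

module Defs where

open import Data.Nat using (ℕ; zero; suc; _≤_; ⌊_/2⌋)
open import Data.List using (List; []; _∷_; _++_; [_])
open import Data.List.Membership.Propositional using (_∈_)
open import Data.Product using (Σ; _×_; ∃)
open import Data.Unit using (⊤)
open import Data.Empty using (⊥)
open import Relation.Binary.PropositionalEquality using (_≡_)
open import Function.Bundles using (_⇔_)

data Letter : Set where
  one two : Letter

Word : Set
Word = List Letter

WordSet : Set₁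
WordSet = Word → Set

IsBinaryTree : WordSet → Set
IsBinaryTree t =
  t [] ×
  (∀ u v → t (u ++ v) → t u) ×
  (∃ λ (L : List Word) → ∀ w → t w → w ∈ L)

IsFull : WordSet → Set
IsFull t = ∀ u → t u → (t (u ++ [ one ]) ⇔ t (u ++ [ two ]))

IsRootOnly : WordSet → Set
IsRootOnly t = ∀ w → (t w ⇔ (w ≡ []))

θ : Word → WordSet → WordSet
θ u t v = t (u ++ v)

data _≺_ : Word → Word → Set where
  []≺∷  : ∀ {x w} → [] ≺ (x ∷ w)
  one≺two : ∀ {u v} → (one ∷ u) ≺ (two ∷ v)
  ∷≺∷   : ∀ {x u v} → u ≺ v → (x ∷ u) ≺ (x ∷ v)

_∧_ : Word → Word → Word
[] ∧ v = []
(x ∷ u) ∧ [] = []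
(one ∷ u) ∧ (one ∷ v) = one ∷ (u ∧ v)
(two ∷ u) ∧ (two ∷ v) = two ∷ (u ∧ v)
(one ∷ u) ∧ (two ∷ v) = []
(two ∷ u) ∧ (one ∷ v) = []

Embeds : WordSet → WordSet → Set
Embeds s t = Σ (Word → Word) λ φ →
  (∀ u → s u → t (φ u)) ×
  (∀ u v → s u → s v → φ u ≡ φ v → u ≡ v) ×
  (∀ u v → s u → s v → u ≺ v → φ u ≺ φ v) ×
  (∀ u v → s u → s v → φ (u ∧ v) ≡ (φ u ∧ φ v))

-- This is exactly the paper's definition: r = 2m+1 gives 1τ_m ∪ 2τ_m
-- (in particular τ_1 = {∅,1,2}), and r = 2m (m ≥ 1) gives 1τ_m ∪ 2τ_{m-1}.
τ : ℕ → WordSet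
τ r [] = ⊤
τ zero (x ∷ w) = ⊥
τ (suc k) (one ∷ w) = τ ⌊ suc k /2⌋ w
τ (suc k) (two ∷ w) = τ ⌊ k /2⌋ w

IsS : WordSet → ℕ → Set
IsS t r = Embeds (τ r) t × (∀ r' → Embeds (τ r') t → r' ≤ r)

module Submission where

-- An embedding of τ r into t either sends the root to a proper word, and then lands inside one
-- of the two subtrees θ [ one ] t, θ [ two ] t, or it sends the root to the root, and then
-- (by order and ∧-preservation) the two subtrees of τ r go into the two subtrees of t.  Since
-- τ (suc k) has subtrees τ ⌊ suc k /2⌋ and τ ⌊ k /2⌋, the best such k is an arithmetic function
-- of 𝒮₁ and 𝒮₂, and conversely such embeddings can always be glued at the root.

open import Defs
open import Data.Nat using (ℕ; zero; suc; _+_; _*_; _⊔_; _⊓_; _<ᵇ_; _≤_; z≤n; s≤s; ⌊_/2⌋)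
open import Data.Nat.Properties using (⌊n/2⌋-mono; *-suc; ≤-antisym; ≤-trans; m≤m⊔n; m≤n⊔m; ⊔-lub; 1+n≰n)
open import Data.Bool using (if_then_else_)
open import Data.List using ([]; _∷_; [_]; drop)
open import Data.Product using (_×_; _,_; proj₁; proj₂)
open import Data.Sum using (_⊎_; inj₁; inj₂)
open import Data.Unit using (tt)
open import Data.Empty using (⊥-elim)
open import Relation.Nullary using (¬_)
open import Relation.Binary.PropositionalEquality using (_≡_; refl; sym; trans; cong; cong₂; subst)
open import Function.Bundles using (_⇔_; mk⇔; Equivalence)

∷-∧ : ∀ x u v → (x ∷ u) ∧ (x ∷ v) ≡ x ∷ (u ∧ v)
∷-∧ one u v = refl
∷-∧ two u v = refl

∷-≺-cancel : ∀ {x u v} → (x ∷ u) ≺ (x ∷ v) → u ≺ v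
∷-≺-cancel (∷≺∷ p) = p

prefix-∷⇒head : ∀ x w v → x ∷ w ≡ (x ∷ w) ∧ v → v ≡ x ∷ drop 1 v
prefix-∷⇒head one w (one ∷ v) _ = refl
prefix-∷⇒head two w (two ∷ v) _ = refl
prefix-∷⇒head one w [] ()
prefix-∷⇒head two w [] ()
prefix-∷⇒head one w (two ∷ v) ()
prefix-∷⇒head two w (one ∷ v) ()

diverging⇒heads : ∀ u v → [] ≺ u → u ≺ v → [] ≡ u ∧ v → u ≡ one ∷ drop 1 u × v ≡ two ∷ drop 1 v
diverging⇒heads (one ∷ u) (two ∷ v) _ _ _ = refl , refl
diverging⇒heads (one ∷ u) (one ∷ v) _ _ ()
diverging⇒heads (two ∷ u) (two ∷ v) _ _ ()

Embeds-restrict : ∀ {s s′ t} → (∀ w → s′ w → s w) → Embeds s t → Embeds s′ t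
Embeds-restrict s′⊆s (φ , ∈t , inj , mono , pres) =
  φ , (λ u s′u → ∈t u (s′⊆s u s′u)) ,
  (λ u v s′u s′v → inj u v (s′⊆s u s′u) (s′⊆s v s′v)) ,
  (λ u v s′u s′v → mono u v (s′⊆s u s′u) (s′⊆s v s′v)) ,
  (λ u v s′u s′v → pres u v (s′⊆s u s′u) (s′⊆s v s′v))

Embeds-fromSubtree : ∀ {s t} x → Embeds s (θ [ x ] t) → Embeds s t
Embeds-fromSubtree x (φ , ∈t , inj , mono , pres) =
  (λ u → x ∷ φ u) , ∈t ,
  (λ u v su sv eq → inj u v su sv (cong (drop 1) eq)) ,
  (λ u v su sv u≺v → ∷≺∷ (mono u v su sv u≺v)) ,
  (λ u v su sv → trans (cong (x ∷_) (pres u v su sv)) (sym (∷-∧ x (φ u) (φ v))))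

Embeds-subtree : ∀ {s t} x → Embeds s t → Embeds (θ [ x ] s) t
Embeds-subtree x (φ , ∈t , inj , mono , pres) =
  (λ v → φ (x ∷ v)) , (λ u su → ∈t (x ∷ u) su) ,
  (λ u v su sv eq → cong (drop 1) (inj (x ∷ u) (x ∷ v) su sv eq)) ,
  (λ u v su sv u≺v → mono (x ∷ u) (x ∷ v) su sv (∷≺∷ u≺v)) ,
  (λ u v su sv → trans (cong φ (sym (∷-∧ x u v))) (pres (x ∷ u) (x ∷ v) su sv))

Embeds-intoSubtree : ∀ {s t} x (E : Embeds s t) →
  (∀ u → s u → proj₁ E u ≡ x ∷ drop 1 (proj₁ E u)) → Embeds s (θ [ x ] t)
Embeds-intoSubtree {s} {t} x (φ , ∈t , inj , mono , pres) head =
  (λ u → drop 1 (φ u)) ,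
  (λ u su → subst t (head u su) (∈t u su)) ,
  (λ u v su sv eq → inj u v su sv (trans (head u su) (trans (cong (x ∷_) eq) (sym (head v sv))))) ,
  (λ u v su sv u≺v → ∷-≺-cancel (subst₂≺ (head u su) (head v sv) (mono u v su sv u≺v))) ,
  (λ u v su sv → trans (cong (drop 1) (pres u v su sv))
    (cong (drop 1) (trans (cong₂ _∧_ (head u su) (head v sv)) (∷-∧ x _ _))))
  where
  subst₂≺ : ∀ {a b c d} → a ≡ b → c ≡ d → a ≺ c → b ≺ d
  subst₂≺ refl refl p = p

Embeds-join : ∀ {s t} → t [] → Embeds (θ [ one ] s) (θ [ one ] t) → Embeds (θ [ two ] s) (θ [ two ] t) →
  Embeds s t
Embeds-join {s} {t} t[] (f , ∈t₁ , inj₁′ , mono₁ , pres₁) (g , ∈t₂ , inj₂′ , mono₂ , pres₂) =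
  φ , ∈t , inj , mono , pres
  where
  φ : Word → Word
  φ [] = []
  φ (one ∷ w) = one ∷ f w
  φ (two ∷ w) = two ∷ g w
  ∈t : ∀ u → s u → t (φ u)
  ∈t [] _ = t[]
  ∈t (one ∷ w) sw = ∈t₁ w sw
  ∈t (two ∷ w) sw = ∈t₂ w sw
  inj : ∀ u v → s u → s v → φ u ≡ φ v → u ≡ v
  inj [] [] _ _ _ = refl
  inj (one ∷ u) (one ∷ v) su sv eq = cong (one ∷_) (inj₁′ u v su sv (cong (drop 1) eq))
  inj (two ∷ u) (two ∷ v) su sv eq = cong (two ∷_) (inj₂′ u v su sv (cong (drop 1) eq))
  inj [] (one ∷ v) _ _ ()
  inj [] (two ∷ v) _ _ ()
  inj (one ∷ u) [] _ _ ()
  inj (two ∷ u) [] _ _ ()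
  inj (one ∷ u) (two ∷ v) _ _ ()
  inj (two ∷ u) (one ∷ v) _ _ ()
  mono : ∀ u v → s u → s v → u ≺ v → φ u ≺ φ v
  mono [] (one ∷ v) _ _ _ = []≺∷
  mono [] (two ∷ v) _ _ _ = []≺∷
  mono (one ∷ u) (two ∷ v) _ _ _ = one≺two
  mono (one ∷ u) (one ∷ v) su sv (∷≺∷ u≺v) = ∷≺∷ (mono₁ u v su sv u≺v)
  mono (two ∷ u) (two ∷ v) su sv (∷≺∷ u≺v) = ∷≺∷ (mono₂ u v su sv u≺v)
  pres : ∀ u v → s u → s v → φ (u ∧ v) ≡ (φ u ∧ φ v)
  pres [] v _ _ = refl
  pres (one ∷ u) [] _ _ = refl
  pres (two ∷ u) [] _ _ = refl
  pres (one ∷ u) (one ∷ v) su sv = cong (one ∷_) (pres₁ u v su sv)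
  pres (two ∷ u) (two ∷ v) su sv = cong (two ∷_) (pres₂ u v su sv)
  pres (one ∷ u) (two ∷ v) _ _ = refl
  pres (two ∷ u) (one ∷ v) _ _ = refl

-- Preserving ∧ makes the image of the root a prefix of every image.
Embeds-rootImage-head : ∀ {s t x w} → s [] → (E : Embeds s t) → proj₁ E [] ≡ x ∷ w →
  ∀ u → s u → proj₁ E u ≡ x ∷ drop 1 (proj₁ E u)
Embeds-rootImage-head {x = x} {w} s[] (φ , _ , _ , _ , pres) eq u su =
  prefix-∷⇒head x w (φ u) (subst (λ r → r ≡ r ∧ φ u) eq (pres [] u s[] su))

Embeds-root : ∀ {s t} → s [] → (E : Embeds s t) →
  Embeds s (θ [ one ] t) ⊎ Embeds s (θ [ two ] t) ⊎ proj₁ E [] ≡ []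
Embeds-root {t = t} s[] E with proj₁ E [] in eq
... | [] = inj₂ (inj₂ refl)
... | one ∷ _ = inj₁ (Embeds-intoSubtree {t = t} one E (Embeds-rootImage-head {t = t} s[] E eq))
... | two ∷ _ = inj₂ (inj₁ (Embeds-intoSubtree {t = t} two E (Embeds-rootImage-head {t = t} s[] E eq)))

Embeds-rootSplit : ∀ {s t} → s [] → s [ one ] → s [ two ] → (E : Embeds s t) → proj₁ E [] ≡ [] →
  Embeds (θ [ one ] s) (θ [ one ] t) × Embeds (θ [ two ] s) (θ [ two ] t)
Embeds-rootSplit {s} {t} s[] s₁ s₂ E@(φ , _ , _ , mono , pres) root =
  Embeds-intoSubtree {t = t} one (Embeds-subtree {t = t} one E) (λ v sv → proj₁ (heads v [] sv s₂)) ,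
  Embeds-intoSubtree {t = t} two (Embeds-subtree {t = t} two E) (λ v sv → proj₂ (heads [] v s₁ sv))
  where
  heads : ∀ u v → s (one ∷ u) → s (two ∷ v) →
    φ (one ∷ u) ≡ one ∷ drop 1 (φ (one ∷ u)) × φ (two ∷ v) ≡ two ∷ drop 1 (φ (two ∷ v))
  heads u v su sv = diverging⇒heads _ _
    (subst (_≺ φ (one ∷ u)) root (mono [] (one ∷ u) s[] su []≺∷))
    (mono (one ∷ u) (two ∷ v) su sv one≺two)
    (trans (sym root) (pres (one ∷ u) (two ∷ v) su sv))

τ-mono : ∀ {m n} → m ≤ n → ∀ w → τ m w → τ n w
τ-mono m≤n [] _ = tt
τ-mono {zero} m≤n (x ∷ w) ()
τ-mono {suc m} {suc n} (s≤s m≤n) (one ∷ w) τw = τ-mono (⌊n/2⌋-mono (s≤s m≤n)) w τw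
τ-mono {suc m} {suc n} (s≤s m≤n) (two ∷ w) τw = τ-mono (⌊n/2⌋-mono m≤n) w τw

Embeds-τ₀ : ∀ {t} → t [] → Embeds (τ 0) t
Embeds-τ₀ {t} t[] = (λ _ → []) , ∈t , inj , mono , λ _ _ _ _ → refl
  where
  ∈t : ∀ u → τ 0 u → t []
  ∈t [] _ = t[]
  inj : ∀ u v → τ 0 u → τ 0 v → [] ≡ [] → u ≡ v
  inj [] [] _ _ _ = refl
  mono : ∀ u v → τ 0 u → τ 0 v → u ≺ v → [] ≺ []
  mono [] [] _ _ ()

IsRootOnly⇒Embeds-τ≡0 : ∀ {t r} → IsRootOnly t → Embeds (τ r) t → r ≡ 0
IsRootOnly⇒Embeds-τ≡0 {r = zero} _ _ = refl
IsRootOnly⇒Embeds-τ≡0 {t} {suc k} rootOnly (φ , ∈t , inj , _ , _)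
  with inj [] [ one ] tt tt (trans (collapse _ (∈t [] tt)) (sym (collapse _ (∈t [ one ] tt))))
  where
  collapse : ∀ w → t w → w ≡ []
  collapse w = Equivalence.to (rootOnly w)
... | ()

-- The largest k such that the subtrees τ ⌊ suc k /2⌋ and τ ⌊ k /2⌋ of τ (suc k) fit into τ a and τ b.
maxJoin : ℕ → ℕ → ℕ
maxJoin zero b = 0
maxJoin (suc a) zero = 1
maxJoin (suc a) (suc b) = suc (suc (maxJoin a b))

maxJoin-fits : ∀ a b → ⌊ suc (maxJoin a b) /2⌋ ≤ a × ⌊ maxJoin a b /2⌋ ≤ b
maxJoin-fits zero b = z≤n , z≤n
maxJoin-fits (suc a) zero = s≤s z≤n , z≤n
maxJoin-fits (suc a) (suc b) with maxJoin-fits a b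
... | p , q = s≤s p , s≤s q

maxJoin-greatest : ∀ k a b → ⌊ suc k /2⌋ ≤ a → ⌊ k /2⌋ ≤ b → k ≤ maxJoin a b
maxJoin-greatest zero a b _ _ = z≤n
maxJoin-greatest (suc zero) (suc a) zero _ _ = s≤s z≤n
maxJoin-greatest (suc zero) (suc a) (suc b) _ _ = s≤s z≤n
maxJoin-greatest (suc (suc k)) (suc a) (suc b) (s≤s p) (s≤s q) = s≤s (s≤s (maxJoin-greatest k a b p q))

suc-maxJoin : ∀ a b → suc (maxJoin a b) ≡ 2 * (a ⊓ b) + (if b <ᵇ a then 1 else 0) + 1
suc-maxJoin zero b = refl
suc-maxJoin (suc a) zero = refl
suc-maxJoin (suc a) (suc b) =
  trans (cong (λ n → suc (suc n)) (suc-maxJoin a b))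
        (sym (cong (λ n → n + (if b <ᵇ a then 1 else 0) + 1) (*-suc 2 (a ⊓ b))))

Embeds-τ-join : ∀ {t a b} → t [] → Embeds (τ a) (θ [ one ] t) → Embeds (τ b) (θ [ two ] t) →
  Embeds (τ (suc (maxJoin a b))) t
Embeds-τ-join {t} {a} {b} t[] E₁ E₂ =
  Embeds-join {t = t} t[] (Embeds-restrict {t = θ [ one ] t} (τ-mono (proj₁ (maxJoin-fits a b))) E₁)
                  (Embeds-restrict {t = θ [ two ] t} (τ-mono (proj₂ (maxJoin-fits a b))) E₂)

Bounds𝒮 : WordSet → ℕ → Set
Bounds𝒮 t n = ∀ r → Embeds (τ r) t → r ≤ n

Embeds-τ-bound : ∀ {t a b} → Bounds𝒮 (θ [ one ] t) a → Bounds𝒮 (θ [ two ] t) b →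
  Bounds𝒮 t ((a ⊔ b) ⊔ suc (maxJoin a b))
Embeds-τ-bound {t} {a} {b} bound₁ bound₂ r E with Embeds-root {t = t} tt E
... | inj₁ E₁ = ≤-trans (bound₁ r E₁) (≤-trans (m≤m⊔n a b) (m≤m⊔n _ _))
... | inj₂ (inj₁ E₂) = ≤-trans (bound₂ r E₂) (≤-trans (m≤n⊔m a b) (m≤m⊔n _ _))
... | inj₂ (inj₂ root) = ≤-trans (rootCase r E root) (m≤n⊔m (a ⊔ b) _)
  where
  rootCase : ∀ r (E : Embeds (τ r) t) → proj₁ E [] ≡ [] → r ≤ suc (maxJoin a b)
  rootCase zero _ _ = z≤n
  rootCase (suc k) E root with Embeds-rootSplit {t = t} tt tt tt E root
  ... | E₁ , E₂ = s≤s (maxJoin-greatest k a b (bound₁ _ E₁) (bound₂ _ E₂))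

𝒮-recursion : ∀ {t s a b} → t [] → IsS t s → IsS (θ [ one ] t) a → IsS (θ [ two ] t) b →
  s ≡ (a ⊔ b) ⊔ suc (maxJoin a b)
𝒮-recursion {t} {s} {a} {b} t[] (E , bound) (E₁ , bound₁) (E₂ , bound₂) =
  ≤-antisym (Embeds-τ-bound {t = t} bound₁ bound₂ s E)
    (⊔-lub (⊔-lub (bound a (Embeds-fromSubtree {t = t} one E₁)) (bound b (Embeds-fromSubtree {t = t} two E₂)))
           (bound _ (Embeds-τ-join {t = t} t[] E₁ E₂)))

full-nonRoot⇒children : ∀ {t x w} → IsBinaryTree t → IsFull t → t (x ∷ w) → t [ one ] × t [ two ]
full-nonRoot⇒children {t} {x} {w} (t[] , prefixClosed , _) full txw = children x (prefixClosed [ x ] w txw)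
  where
  children : ∀ x → t [ x ] → t [ one ] × t [ two ]
  children one t₁ = t₁ , Equivalence.to (full [] t[]) t₁
  children two t₂ = Equivalence.from (full [] t[]) t₂ , t₂

Bounds𝒮-0⇒IsRootOnly : ∀ {t} → IsBinaryTree t → IsFull t → Bounds𝒮 t 0 → IsRootOnly t
Bounds𝒮-0⇒IsRootOnly (t[] , _) full bound [] = mk⇔ (λ _ → refl) (λ _ → t[])
Bounds𝒮-0⇒IsRootOnly {t} bt@(t[] , _) full bound (x ∷ w) = mk⇔ nonRoot⇒⊥ (λ ())
  where
  nonRoot⇒⊥ : t (x ∷ w) → x ∷ w ≡ []
  nonRoot⇒⊥ txw with full-nonRoot⇒children bt full txw
  ... | t₁ , t₂ = ⊥-elim (1+n≰n (bound 1
        (Embeds-τ-join {t = t} t[] (Embeds-τ₀ {θ [ one ] t} t₁) (Embeds-τ₀ {θ [ two ] t} t₂))))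

proposition2p1 : (t : WordSet) → IsBinaryTree t → IsFull t →
    (∀ s → IsS t s → ((s ≡ 0) ⇔ IsRootOnly t)) ×
    (¬ IsRootOnly t → ∀ s s₁ s₂ → IsS t s → IsS (θ [ one ] t) s₁ → IsS (θ [ two ] t) s₂ →
      s ≡ (s₁ ⊔ s₂) ⊔ (2 * (s₁ ⊓ s₂) + (if s₂ <ᵇ s₁ then 1 else 0) + 1))
proposition2p1 t bt@(t[] , _) full = zeroIffRootOnly , recursion
  where
  zeroIffRootOnly : ∀ s → IsS t s → ((s ≡ 0) ⇔ IsRootOnly t)
  zeroIffRootOnly s (E , bound) =
    mk⇔ (λ { refl → Bounds𝒮-0⇒IsRootOnly bt full bound }) (λ rootOnly → IsRootOnly⇒Embeds-τ≡0 rootOnly E)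

  recursion : ¬ IsRootOnly t → ∀ s s₁ s₂ → IsS t s → IsS (θ [ one ] t) s₁ → IsS (θ [ two ] t) s₂ →
    s ≡ (s₁ ⊔ s₂) ⊔ (2 * (s₁ ⊓ s₂) + (if s₂ <ᵇ s₁ then 1 else 0) + 1)
  recursion _ s s₁ s₂ S S₁ S₂ =
    trans (𝒮-recursion {t = t} t[] S S₁ S₂) (cong ((s₁ ⊔ s₂) ⊔_) (suc-maxJoin s₁ s₂))
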